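{- Let $G$ be a finite, simple, connected graph which is not $P_2$, $Q$, or $L(Q)$ (as defined in the context), and suppose $\delta(G) \geq 3$. Then for all $v \in V(G)$ and all integers $m \geq 1$ we have $|\langle v\rangle_{m+1}| > |\langle v\rangle_m|$.
   Context: $P_2$ is the path with two vertices and one edge; $Q$ is the graph obtained from a triangle by attaching one pendant edge to one of its vertices; $L(Q)$ is its line graph ($K_4$ minus an edge). $\delta(G)$ is the minimum degree. For a simple graph $H$, the line graph $L(H)$ has vertex set $E(H)$, two edges adjacent if they share an endpoint; $L^k(H) = L(L^{k-1}(H))$. Every vertex of $L^2(H)$ is a pair $\{\{u,v\},\{v,w\}\}$ of distinct edges of $H$ sharing the vertex $v$; define $f_H: V(L^2(H)) \to V(H)$ by $f_H(\{\{u,v\},\{v,w\}\}) = v$. For $v \in V(G)$ define $\langle v\rangle_1 = f_G^{ -1}(v)$ and recursively $\langle v\rangle_{k+1} = \bigcup_{u \in \langle v\rangle_k} f_{L^{2k}(G)}^{ -1}(u) \subseteq V(L^{2k+2}(G))$. -}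

module Defs where

open import Data.Nat using (ℕ; zero; suc; _<ᵇ_; _≤_; _<_)
open import Data.Bool using (Bool; true; false; _∧_; _∨_; not; if_then_else_)
open import Data.Fin using (Fin; toℕ; #_)
open import Data.Fin.Subset using (Subset; ⁅_⁆)
open import Data.Product using (_×_; _,_; Σ)
open import Data.List using (List; []; _∷_; length; lookup; allFin; filterᵇ; concatMap; map)
open import Data.Vec using (tabulate)
open import Function.Bundles using (_↔_; Inverse)
open import Relation.Binary.PropositionalEquality using (_≡_)

record Graph : Set where
  field
    n   : ℕ
    adj : Fin n → Fin n → Bool
open Graph public

V : Graph → Set
V G = Fin (n G)

IsSimple : Graph → Set
IsSimple G = (∀ i j → adj G i j ≡ adj G j i) × (∀ i → adj G i i ≡ false)

_==_ : ∀ {k} → Fin k → Fin k → Bool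
i == j = ((toℕ i) Data.Nat.≡ᵇ (toℕ j))

edges : (G : Graph) → List (V G × V G)
edges G = filterᵇ (λ { (i , j) → (toℕ i <ᵇ toℕ j) ∧ adj G i j })
                  (concatMap (λ i → map (i ,_) (allFin (n G))) (allFin (n G)))

shareEnd : ∀ {k} → (Fin k × Fin k) → (Fin k × Fin k) → Bool
shareEnd (a , b) (c , d) = (a == c) ∨ (a == d) ∨ (b == c) ∨ (b == d)

L : Graph → Graph
L G = record
  { n   = length (edges G)
  ; adj = λ e f → not (e == f) ∧ shareEnd (lookup (edges G) e) (lookup (edges G) f) }

L2pow : Graph → ℕ → Graph
L2pow G zero    = G
L2pow G (suc k) = L (L (L2pow G k))

common : ∀ {k} → (Fin k × Fin k) → (Fin k × Fin k) → Fin k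
common (a , b) (c , d) = if (a == c) ∨ (a == d) then a else b

f : (H : Graph) → V (L (L H)) → V H
f H x with lookup (edges (L H)) x
... | (e₁ , e₂) = common (lookup (edges H) e₁) (lookup (edges H) e₂)

-- ⟨v⟩_k ⊆ V(L^(2k)(G)); ⟨v⟩_0 = {v}, ⟨v⟩_(k+1) = f_{L^(2k)G}⁻¹(⟨v⟩_k)
-- (so ⟨v⟩_1 = f_G⁻¹(v) as in the paper)
angle : (G : Graph) → V G → (k : ℕ) → Subset (n (L2pow G k))
angle G v zero    = ⁅ v ⁆
angle G v (suc k) = tabulate (λ x → Data.Vec.lookup (angle G v k) (f (L2pow G k) x))

degree : (G : Graph) → V G → ℕ
degree G v = Data.Fin.Subset.∣ tabulate (adj G v) ∣

mindeg≥ : Graph → ℕ → Set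
mindeg≥ G d = ∀ v → d ≤ degree G v

data Reach (G : Graph) : V G → V G → Set where
  here : ∀ {u} → Reach G u u
  step : ∀ {u w x} → adj G u w ≡ true → Reach G w x → Reach G u x

Connected : Graph → Set
Connected G = ∀ u w → Reach G u w

_≅_ : Graph → Graph → Set
G ≅ H = Σ (V G ↔ V H) λ φ → ∀ i j → adj G i j ≡ adj H (Inverse.to φ i) (Inverse.to φ j)

adjList : ∀ {k} → List (Fin k × Fin k) → Fin k → Fin k → Bool
adjList [] i j = false
adjList ((a , b) ∷ es) i j =
  ((a == i) ∧ (b == j)) ∨ ((a == j) ∧ (b == i)) ∨ adjList es i j

P2 : Graph
P2 = record { n = 2 ; adj = adjList ((# 0 , # 1) ∷ []) }

Q : Graph
Q = record { n = 4 ; adj = adjList ((# 0 , # 1) ∷ (# 0 , # 2) ∷ (# 1 , # 2) ∷ (# 0 , # 3) ∷ []) }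

-- L(Q) ≅ K₄ minus the edge 2–3
LQ : Graph
LQ = record { n = 4 ; adj = adjList ((# 0 , # 1) ∷ (# 0 , # 2) ∷ (# 0 , # 3) ∷ (# 1 , # 2) ∷ (# 1 , # 3) ∷ []) }

-- If u has three distinct neighbours a, b, c, then {ua,ub} and {ua,uc} are two distinct vertices of
-- L²(H) lying over u, so every fibre of f_H has at least two points. Minimum degree 3 passes from H to
-- L(H) (an edge ab meets two further edges at a and one at b), hence every f_{L^(2k) G} has this
-- property, and ⟨v⟩_(k+1) = f⁻¹(⟨v⟩_k) is strictly larger than the nonempty set ⟨v⟩_k.
module Submission where

open import Defs
open import Data.Nat using (ℕ; _≤_; _<_; zero; suc; z≤n; s≤s; _<ᵇ_)
import Data.Nat.Properties as ℕₚ
open import Data.Fin using (Fin; toℕ)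
import Data.Fin.Properties as Finₚ
open import Data.Fin.Subset using (∣_∣; Subset; _∈_; _∉_; _-_; _─_; ⁅_⁆; Nonempty; inside; outside)
open import Data.Fin.Subset.Properties
  using (x∈⁅x⁆; p─⊥≡p; p─q⊆p; x∈p∧x≢y⇒x∈p-y; x∈p⇒∣p-x∣<∣p∣; nonempty?; Empty-unique; ∣⊥∣≡0)
open import Data.Vec using (_∷_; []; tabulate; lookup; here; there)
open import Data.Vec.Properties using (lookup∘tabulate; []=⇒lookup; lookup⇒[]=)
open import Data.Bool using (Bool; true; false; _∧_; _∨_; not; T)
open import Data.Bool.Properties using (T-≡; T-∧; ∨-zeroʳ; ∨-commutativeMonoid)
open import Algebra.Bundles using (CommutativeMonoid)
open import Algebra.Properties.CommutativeSemigroup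
  (CommutativeMonoid.commutativeSemigroup ∨-commutativeMonoid) using (x∙yz≈y∙xz)
open import Data.List as List using (List)
import Data.List.Relation.Unary.Any as Any
import Data.List.Relation.Unary.Any.Properties as AnyP
open import Data.List.Membership.Propositional using () renaming (_∈_ to _∈ₗ_)
import Data.List.Membership.Propositional.Properties as MemP
open import Data.Product using (∃; _×_; _,_; proj₁; proj₂)
open import Data.Sum as Sum using (_⊎_; inj₁; inj₂)
open import Function using (_∘_)
open import Function.Bundles using (Equivalence)
open import Function.Definitions using (Injective)
open import Relation.Nullary using (¬_; yes; no; contradiction)
open import Relation.Nullary.Decidable using (T?)
open import Relation.Binary.Definitions using (tri<; tri≈; tri>)
open import Relation.Binary.PropositionalEquality

record Two {k} (P : Fin k → Set) : Set where
  constructor two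
  field
    {x y} : Fin k
    px    : P x
    py    : P y
    x≢y   : x ≢ y

record Three {k} (P : Fin k → Set) : Set where
  constructor three
  field
    {x y z} : Fin k
    px      : P x
    py      : P y
    pz      : P z
    x≢y     : x ≢ y
    x≢z     : x ≢ z
    y≢z     : y ≢ z

private
  variable
    m k : ℕ

x∈p─q⇒x∉q : {p q : Subset m} {x : Fin m} → x ∈ p ─ q → x ∉ q
x∈p─q⇒x∉q {p = _ ∷ _} {q = inside ∷ _} () here
x∈p─q⇒x∉q {p = _ ∷ _} {q = _ ∷ _} (there x∈p─q) (there x∈q) = x∈p─q⇒x∉q x∈p─q x∈q

x∈p-y⇒x≢y : {p : Subset m} {x y : Fin m} → x ∈ p - y → x ≢ y
x∈p-y⇒x≢y {y = y} x∈p-y refl = x∈p─q⇒x∉q x∈p-y (x∈⁅x⁆ y)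

x∈p⇒∣p∣≡1+∣p-x∣ : {p : Subset m} {x : Fin m} → x ∈ p → ∣ p ∣ ≡ suc ∣ p - x ∣
x∈p⇒∣p∣≡1+∣p-x∣ {p = inside ∷ p}  here        = cong (suc ∘ ∣_∣) (sym (p─⊥≡p p))
x∈p⇒∣p∣≡1+∣p-x∣ {p = inside ∷ p}  (there x∈p) = cong suc (x∈p⇒∣p∣≡1+∣p-x∣ x∈p)
x∈p⇒∣p∣≡1+∣p-x∣ {p = outside ∷ p} (there x∈p) = x∈p⇒∣p∣≡1+∣p-x∣ x∈p

0<∣p∣⇒Nonempty : {p : Subset m} → 0 < ∣ p ∣ → Nonempty p
0<∣p∣⇒Nonempty {m} {p} 0<∣p∣ with nonempty? p
... | yes p≢∅ = p≢∅
... | no  p≡∅ = contradiction (trans (cong ∣_∣ (Empty-unique p≡∅)) (∣⊥∣≡0 m)) (ℕₚ.>⇒≢ 0<∣p∣)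

pick-member : {k : ℕ} (p : Subset m) → suc k ≤ ∣ p ∣ → ∃ λ x → x ∈ p × k ≤ ∣ p - x ∣
pick-member p k<∣p∣ with 0<∣p∣⇒Nonempty (ℕₚ.≤-trans (s≤s z≤n) k<∣p∣)
... | x , x∈p = x , x∈p , ℕₚ.≤-pred (subst (_ ≤_) (x∈p⇒∣p∣≡1+∣p-x∣ x∈p) k<∣p∣)

three-members : (p : Subset m) → 3 ≤ ∣ p ∣ → Three (_∈ p)
three-members p 3≤∣p∣ with pick-member p 3≤∣p∣
... | x , x∈p , 2≤∣p-x∣ with pick-member (p - x) 2≤∣p-x∣
... | y , y∈p-x , 1≤∣p-x-y∣ with pick-member (p - x - y) 1≤∣p-x-y∣
... | z , z∈p-x-y , _ = record
  { px  = x∈p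
  ; py  = p─q⊆p p _ y∈p-x
  ; pz  = p─q⊆p p _ z∈p-x
  ; x≢y = ≢-sym (x∈p-y⇒x≢y y∈p-x)
  ; x≢z = ≢-sym (x∈p-y⇒x≢y z∈p-x)
  ; y≢z = ≢-sym (x∈p-y⇒x≢y z∈p-x-y)
  }
  where
  z∈p-x : z ∈ p - x
  z∈p-x = p─q⊆p (p - x) _ z∈p-x-y

∣p∣≤∣q∣-by-injection : (p : Subset m) (q : Subset k) (φ : Fin m → Fin k) →
                       (∀ {x} → x ∈ p → φ x ∈ q) → Injective _≡_ _≡_ φ → ∣ p ∣ ≤ ∣ q ∣
∣p∣≤∣q∣-by-injection []            q φ φ∈q φ-inj = z≤n
∣p∣≤∣q∣-by-injection (outside ∷ p) q φ φ∈q φ-inj =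
  ∣p∣≤∣q∣-by-injection p q (φ ∘ Fin.suc) (φ∈q ∘ there) (Finₚ.suc-injective ∘ φ-inj)
∣p∣≤∣q∣-by-injection (inside ∷ p)  q φ φ∈q φ-inj =
  ℕₚ.≤-trans (s≤s ∣p∣≤∣q-φ₀∣) (x∈p⇒∣p-x∣<∣p∣ (φ∈q here))
  where
  ∣p∣≤∣q-φ₀∣ : ∣ p ∣ ≤ ∣ q - φ Fin.zero ∣
  ∣p∣≤∣q-φ₀∣ = ∣p∣≤∣q∣-by-injection p (q - φ Fin.zero) (φ ∘ Fin.suc)
    (λ x∈p → x∈p∧x≢y⇒x∈p-y (φ∈q (there x∈p)) (Finₚ.0≢1+n ∘ sym ∘ φ-inj))
    (Finₚ.suc-injective ∘ φ-inj)

∣p∣<∣q∣-by-injection : (p : Subset m) (q : Subset k) (φ : Fin m → Fin k) →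
                       (∀ {x} → x ∈ p → φ x ∈ q) → Injective _≡_ _≡_ φ →
                       ∀ {y} → y ∈ q → (∀ {x} → x ∈ p → φ x ≢ y) → ∣ p ∣ < ∣ q ∣
∣p∣<∣q∣-by-injection p q φ φ∈q φ-inj {y} y∈q φ≢y =
  ℕₚ.≤-trans (s≤s (∣p∣≤∣q∣-by-injection p (q - y) φ φ∈q-y φ-inj)) (x∈p⇒∣p-x∣<∣p∣ y∈q)
  where
  φ∈q-y : ∀ {x} → x ∈ p → φ x ∈ q - y
  φ∈q-y x∈p = x∈p∧x≢y⇒x∈p-y (φ∈q x∈p) (φ≢y x∈p)

∈-tabulate⁺ : {P : Fin m → Bool} {x : Fin m} → P x ≡ true → x ∈ tabulate P
∈-tabulate⁺ {P = P} {x} Px = lookup⇒[]= x (tabulate P) (trans (lookup∘tabulate P x) Px)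

∈-tabulate⁻ : {P : Fin m → Bool} {x : Fin m} → x ∈ tabulate P → P x ≡ true
∈-tabulate⁻ {P = P} {x} x∈P = trans (sym (lookup∘tabulate P x)) ([]=⇒lookup x∈P)

preimage : (Fin k → Fin m) → Subset m → Subset k
preimage g p = tabulate (λ y → lookup p (g y))

∈-preimage⁺ : {g : Fin k → Fin m} {p : Subset m} {y : Fin k} → g y ∈ p → y ∈ preimage g p
∈-preimage⁺ gy∈p = ∈-tabulate⁺ ([]=⇒lookup gy∈p)

Fibres₂ : (Fin k → Fin m) → Set
Fibres₂ g = ∀ x → Two (λ y → g y ≡ x)

preimage-nonempty : (g : Fin k → Fin m) → Fibres₂ g →
                    {p : Subset m} → Nonempty p → Nonempty (preimage g p)
preimage-nonempty g fibres (x , x∈p) =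
  Two.x (fibres x) , ∈-preimage⁺ (subst (_∈ _) (sym (Two.px (fibres x))) x∈p)

∣p∣<∣preimage∣ : {m k : ℕ} (g : Fin k → Fin m) → Fibres₂ g →
                 {p : Subset m} → Nonempty p → ∣ p ∣ < ∣ preimage g p ∣
∣p∣<∣preimage∣ {m} {k} g fibres {p} (x₀ , x₀∈p) =
  ∣p∣<∣q∣-by-injection p (preimage g p) section
    (λ {x} x∈p → ∈-preimage⁺ (subst (_∈ p) (sym (g∘section x)) x∈p))
    (λ {x} {x'} eq → trans (sym (g∘section x)) (trans (cong g eq) (g∘section x')))
    (∈-preimage⁺ (subst (_∈ p) (sym (Two.py (fibres x₀))) x₀∈p))
    misses
  where
  section : Fin m → Fin k
  section x = Two.x (fibres x)
  g∘section : ∀ x → g (section x) ≡ x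
  g∘section x = Two.px (fibres x)
  misses : ∀ {x} → x ∈ p → section x ≢ Two.y (fibres x₀)
  misses {x} _ eq with trans (sym (g∘section x)) (trans (cong g eq) (Two.py (fibres x₀)))
  ... | refl = Two.x≢y (fibres x₀) eq

==-refl : (i : Fin m) → (i == i) ≡ true
==-refl i = Equivalence.to T-≡ (ℕₚ.≡⇒≡ᵇ (toℕ i) (toℕ i) refl)

==⇒≡ : {i j : Fin m} → (i == j) ≡ true → i ≡ j
==⇒≡ {i = i} {j} i==j = Finₚ.toℕ-injective (ℕₚ.≡ᵇ⇒≡ (toℕ i) (toℕ j) (Equivalence.from T-≡ i==j))

≢⇒==-false : {i j : Fin m} → i ≢ j → (i == j) ≡ false
≢⇒==-false {i = i} {j} i≢j with i == j in i==j
... | true  = contradiction (==⇒≡ i==j) i≢j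
... | false = refl

==-sym : (i j : Fin m) → (i == j) ≡ (j == i)
==-sym i j with i Finₚ.≟ j
... | yes refl = refl
... | no  i≢j  = trans (≢⇒==-false i≢j) (sym (≢⇒==-false (≢-sym i≢j)))

Joins : Fin m × Fin m → Fin m → Fin m → Set
Joins e x y = e ≡ (x , y) ⊎ e ≡ (y , x)

Joins-sym : {e : Fin m × Fin m} {x y : Fin m} → Joins e x y → Joins e y x
Joins-sym = Sum.swap

Joins-endpoint : {e : Fin m × Fin m} {x y z w : Fin m} → Joins e x y → Joins e z w → x ≡ z ⊎ x ≡ w
Joins-endpoint (inj₁ refl) (inj₁ refl) = inj₁ refl
Joins-endpoint (inj₁ refl) (inj₂ refl) = inj₂ refl
Joins-endpoint (inj₂ refl) (inj₁ refl) = inj₂ refl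
Joins-endpoint (inj₂ refl) (inj₂ refl) = inj₁ refl

Joins-≢ : {e e' : Fin m × Fin m} {x y z w : Fin m} → Joins e x y → Joins e' z w → x ≢ z → x ≢ w → e ≢ e'
Joins-≢ e-xy e'-zw x≢z x≢w refl = Sum.[ x≢z , x≢w ] (Joins-endpoint e-xy e'-zw)

shareEnd-Joins : {e e' : Fin m × Fin m} {x y z : Fin m} → Joins e x y → Joins e' x z → shareEnd e e' ≡ true
shareEnd-Joins {x = x} (inj₁ refl) (inj₁ refl) rewrite ==-refl x = refl
shareEnd-Joins {x = x} {z = z} (inj₁ refl) (inj₂ refl) rewrite ==-refl x = ∨-zeroʳ (x == z)
shareEnd-Joins {x = x} {y} {z} (inj₂ refl) (inj₁ refl)
  rewrite ==-refl x | ∨-zeroʳ (y == z) = ∨-zeroʳ (y == x)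
shareEnd-Joins {x = x} {y} {z} (inj₂ refl) (inj₂ refl)
  rewrite ==-refl x | ∨-zeroʳ (x == z) | ∨-zeroʳ (y == x) = ∨-zeroʳ (y == z)

common-Joins : {e e' : Fin m × Fin m} {u x y : Fin m} → Joins e u x → Joins e' u y →
               x ≢ u → x ≢ y → common e e' ≡ u
common-Joins {u = u} (inj₁ refl) (inj₁ refl) _ _ rewrite ==-refl u = refl
common-Joins {u = u} {y = y} (inj₁ refl) (inj₂ refl) _ _ rewrite ==-refl u | ∨-zeroʳ (u == y) = refl
common-Joins (inj₂ refl) (inj₁ refl) x≢u x≢y rewrite ≢⇒==-false x≢u | ≢⇒==-false x≢y = refl
common-Joins (inj₂ refl) (inj₂ refl) x≢u x≢y rewrite ≢⇒==-false x≢u | ≢⇒==-false x≢y = refl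

shareEnd-sym : (e e' : Fin m × Fin m) → shareEnd e e' ≡ shareEnd e' e
shareEnd-sym (i , j) (k , l) rewrite ==-sym i k | ==-sym i l | ==-sym j k | ==-sym j l =
  cong ((k == i) ∨_) (x∙yz≈y∙xz (l == i) (k == j) (l == j))

edge : (H : Graph) → V (L H) → V H × V H
edge H = List.lookup (edges H)

module _ (H : Graph) where

  private
    IsEdgePair : V H × V H → Bool
    IsEdgePair (i , j) = (toℕ i <ᵇ toℕ j) ∧ adj H i j

    pairs : List (V H × V H)
    pairs = List.concatMap (λ i → List.map (i ,_) (List.allFin (n H))) (List.allFin (n H))

  ∈-edges⁺ : {i j : V H} → toℕ i < toℕ j → adj H i j ≡ true → (i , j) ∈ₗ edges H
  ∈-edges⁺ {i} {j} i<j ij = MemP.∈-filter⁺ (T? ∘ IsEdgePair) {xs = pairs}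
    (MemP.∈-concatMap⁺ (λ i → List.map (i ,_) (List.allFin (n H)))
      (Any.map (λ { refl → MemP.∈-map⁺ (i ,_) (MemP.∈-allFin j) }) (MemP.∈-allFin i)))
    (Equivalence.from T-∧ (ℕₚ.<⇒<ᵇ i<j , Equivalence.from T-≡ ij))

  edge-adjacent : (e : V (L H)) → adj H (proj₁ (edge H e)) (proj₂ (edge H e)) ≡ true
  edge-adjacent e = Equivalence.to T-≡ (proj₂ (Equivalence.to T-∧
    (proj₂ (MemP.∈-filter⁻ (T? ∘ IsEdgePair) {xs = pairs} (MemP.∈-lookup e)))))

  module _ (simple : IsSimple H) where

    adjacent⇒≢ : {i j : V H} → adj H i j ≡ true → i ≢ j
    adjacent⇒≢ {i} ij refl = contradiction (trans (sym ij) (proj₂ simple i)) λ ()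

    edge-index : {i j : V H} → adj H i j ≡ true → ∃ λ e → Joins (edge H e) i j
    edge-index {i} {j} ij with ℕₚ.<-cmp (toℕ i) (toℕ j)
    ... | tri< i<j _ _ = let p = ∈-edges⁺ i<j ij in
                         Any.index p , inj₁ (sym (AnyP.lookup-index p))
    ... | tri≈ _ i≡j _ = contradiction (Finₚ.toℕ-injective i≡j) (adjacent⇒≢ ij)
    ... | tri> _ _ j<i = let p = ∈-edges⁺ j<i (trans (proj₁ simple j i) ij) in
                         Any.index p , inj₂ (sym (AnyP.lookup-index p))

  edge-≢ : {e e' : V (L H)} {x y z w : V H} → Joins (edge H e) x y → Joins (edge H e') z w →
           x ≢ z → x ≢ w → e ≢ e'
  edge-≢ e-xy e'-zw x≢z x≢w = Joins-≢ e-xy e'-zw x≢z x≢w ∘ cong (edge H)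

  L-adjacent : {e e' : V (L H)} {u x y : V H} → Joins (edge H e) u x → Joins (edge H e') u y →
               x ≢ u → x ≢ y → adj (L H) e e' ≡ true
  L-adjacent e-ux e'-uy x≢u x≢y rewrite ≢⇒==-false (edge-≢ (Joins-sym e-ux) e'-uy x≢u x≢y) =
    shareEnd-Joins e-ux e'-uy

  L-isSimple : IsSimple (L H)
  L-isSimple = (λ e e' → cong₂ _∧_ (cong not (==-sym e e')) (shareEnd-sym (edge H e) (edge H e')))
             , (λ e → cong (λ b → not b ∧ shareEnd (edge H e) (edge H e)) (==-refl e))

Three-avoiding : {P : Fin m → Set} → Three P → (b : Fin m) → Two (λ c → P c × c ≢ b)
Three-avoiding (three {x} {y} px py pz x≢y x≢z y≢z) b with x Finₚ.≟ b | y Finₚ.≟ b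
... | yes refl | _        = two (py , ≢-sym x≢y) (pz , ≢-sym x≢z) y≢z
... | no  x≢b  | yes refl = two (px , x≢b) (pz , ≢-sym y≢z) x≢z
... | no  x≢b  | no  y≢b  = two (px , x≢b) (py , y≢b) x≢y

ThreeNeighbours : Graph → Set
ThreeNeighbours H = ∀ u → Three (λ w → adj H u w ≡ true)

L-threeNeighbours : (H : Graph) → IsSimple H → ThreeNeighbours H → ThreeNeighbours (L H)
L-threeNeighbours H simple nbrs e = neighbours (inj₁ refl) (edge-adjacent H e)
  where
  neighbours : {a b : V H} → Joins (edge H e) a b → adj H a b ≡ true → Three (λ e' → adj (L H) e e' ≡ true)
  neighbours {a} {b} e-ab ab
    with Three-avoiding (nbrs a) b | Three-avoiding (nbrs b) a
  ... | two (ac₁ , c₁≢b) (ac₂ , c₂≢b) c₁≢c₂ | two (bc₃ , c₃≢a) _ _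
    with edge-index H simple ac₁ | edge-index H simple ac₂ | edge-index H simple bc₃
  ... | e₁ , e₁-ac₁ | e₂ , e₂-ac₂ | e₃ , e₃-bc₃ = record
    { px  = L-adjacent H e-ab e₁-ac₁ (≢-sym a≢b) (≢-sym c₁≢b)
    ; py  = L-adjacent H e-ab e₂-ac₂ (≢-sym a≢b) (≢-sym c₂≢b)
    ; pz  = L-adjacent H (Joins-sym e-ab) e₃-bc₃ a≢b (≢-sym c₃≢a)
    ; x≢y = edge-≢ H (Joins-sym e₁-ac₁) e₂-ac₂ (≢-sym (adjacent⇒≢ H simple ac₁)) c₁≢c₂
    ; x≢z = edge-≢ H e₁-ac₁ e₃-bc₃ a≢b (≢-sym c₃≢a)
    ; y≢z = edge-≢ H e₂-ac₂ e₃-bc₃ a≢b (≢-sym c₃≢a)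
    }
    where
    a≢b : a ≢ b
    a≢b = adjacent⇒≢ H simple ab

f-Joins : (H : Graph) (x : V (L (L H))) {e₁ e₂ : V (L H)} {u s t : V H} →
          Joins (edge (L H) x) e₁ e₂ → Joins (edge H e₁) u s → Joins (edge H e₂) u t →
          s ≢ u → t ≢ u → s ≢ t → f H x ≡ u
f-Joins H x (inj₁ x-e₁e₂) e₁-us e₂-ut s≢u t≢u s≢t rewrite x-e₁e₂ =
  common-Joins e₁-us e₂-ut s≢u s≢t
f-Joins H x (inj₂ x-e₂e₁) e₁-us e₂-ut s≢u t≢u s≢t rewrite x-e₂e₁ =
  common-Joins e₂-ut e₁-us t≢u (≢-sym s≢t)

L²-fibres : (H : Graph) → IsSimple H → ThreeNeighbours H → Fibres₂ (f H)
L²-fibres H simple nbrs u = fibre (nbrs u)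
  where
  away : {w : V H} → adj H u w ≡ true → w ≢ u
  away uw = ≢-sym (adjacent⇒≢ H simple uw)

  fibre : Three (λ w → adj H u w ≡ true) → Two (λ x → f H x ≡ u)
  fibre (three ua ub uc a≢b a≢c b≢c)
    with edge-index H simple ua | edge-index H simple ub | edge-index H simple uc
  ... | eA , eA-ua | eB , eB-ub | eC , eC-uc
    with edge-index (L H) (L-isSimple H) (L-adjacent H eA-ua eB-ub (away ua) a≢b)
       | edge-index (L H) (L-isSimple H) (L-adjacent H eA-ua eC-uc (away ua) a≢c)
  ... | x , x-AB | y , y-AC =
    two (f-Joins H x x-AB eA-ua eB-ub (away ua) (away ub) a≢b)
        (f-Joins H y y-AC eA-ua eC-uc (away ua) (away uc) a≢c)
        (edge-≢ (L H) (Joins-sym x-AB) y-AC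
          (edge-≢ H (Joins-sym eB-ub) eA-ua (away ub) (≢-sym a≢b))
          (edge-≢ H (Joins-sym eB-ub) eC-uc (away ub) b≢c))

mindeg≥3⇒ThreeNeighbours : (G : Graph) → mindeg≥ G 3 → ThreeNeighbours G
mindeg≥3⇒ThreeNeighbours G δ≥3 u with three-members (tabulate (adj G u)) (δ≥3 u)
... | three px py pz x≢y x≢z y≢z =
  three (∈-tabulate⁻ px) (∈-tabulate⁻ py) (∈-tabulate⁻ pz) x≢y x≢z y≢z

L-simple×threeNeighbours : (H : Graph) →
                           IsSimple H × ThreeNeighbours H → IsSimple (L H) × ThreeNeighbours (L H)
L-simple×threeNeighbours H (simple , nbrs) = L-isSimple H , L-threeNeighbours H simple nbrs

L2pow-simple×threeNeighbours : (G : Graph) → IsSimple G × ThreeNeighbours G →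
                               ∀ k → IsSimple (L2pow G k) × ThreeNeighbours (L2pow G k)
L2pow-simple×threeNeighbours G good zero    = good
L2pow-simple×threeNeighbours G good (suc k) =
  L-simple×threeNeighbours _ (L-simple×threeNeighbours _ (L2pow-simple×threeNeighbours G good k))

lemma4 : (G : Graph) → IsSimple G → Connected G
    → ¬ (G ≅ P2) → ¬ (G ≅ Q) → ¬ (G ≅ LQ)
    → mindeg≥ G 3
    → (v : V G) (m : ℕ) → 1 ≤ m
    → ∣ angle G v m ∣ < ∣ angle G v (ℕ.suc m) ∣
lemma4 G simple _ _ _ _ δ≥3 v m _ = ∣p∣<∣preimage∣ (f (L2pow G m)) (fibres m) (angle-nonempty m)
  where
  fibres : ∀ k → Fibres₂ (f (L2pow G k))
  fibres k with L2pow-simple×threeNeighbours G (simple , mindeg≥3⇒ThreeNeighbours G δ≥3) k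
  ... | simpleₖ , nbrsₖ = L²-fibres (L2pow G k) simpleₖ nbrsₖ

  angle-nonempty : ∀ k → Nonempty (angle G v k)
  angle-nonempty zero    = v , x∈⁅x⁆ v
  angle-nonempty (suc k) = preimage-nonempty (f (L2pow G k)) (fibres k) (angle-nonempty k)
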